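{- Let $\mathcal{T}$ be a tableau which has exactly one entry equal to $\infty$ and let $x$ be a finite number. Then $\operatorname{sh}^*\mathcal{T}\nearrow \operatorname{sh}^*(\mathcal{T}\leftarrow x)$ in the augmented Young graph.
   Context: Boxes are identified with coordinates $(x,y)\in\mathbb{N}_0^2$ of their lower-left corners (French convention; $x$ = column, $y$ = row, row $0$ at the bottom). $\infty$ is a symbol strictly bigger than all other entries. Schensted row insertion $\mathcal{T}\leftarrow a$: $a$ is inserted into row $0$ into the leftmost box with entry strictly bigger than $a$; if none, $a$ goes into the leftmost empty box of the row and the procedure stops; otherwise the previous content is bumped into row $1$ and inserted there by the same rule, etc. For Young diagrams, $\lambda\nearrow\widetilde\lambda$ means $\widetilde\lambda$ is obtained from $\lambda$ by adding one box. An outer corner of a Young diagram $\lambda$ is a box not in $\lambda$ whose addition to $\lambda$ gives a Young diagram. An augmented Young diagram is a pair $\Lambda=(\lambda,\Box)$ where $\lambda$ is a Young diagram (the regular part) and $\Box$ is an outer corner of $\lambda$ (the special box). For a tableau $\mathcal{T}$ with exactly one entry equal to $\infty$, its augmented shape is $\operatorname{sh}^*\mathcal{T}=(\text{shape of }\mathcal{T}\text{ with the box containing }\infty\text{ removed},\ \text{position of the box containing }\infty)$. Augmented Young graph: $(\lambda,\Box)\nearrow(\widetilde\lambda,\widetilde\Box)$ iff $\lambda\nearrow\widetilde\lambda$ and $\widetilde\Box$ is the outer corner of $\widetilde\lambda$ lying in the row directly above $\Box$ if $\widetilde\lambda/\lambda=\{\Box\}$, while $\widetilde\Box=\Box$ otherwise.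 -}

module Defs where

open import Level using (Level; _⊔_)
open import Data.Nat using (ℕ; zero; suc; _+_; _≤_; _<_)
open import Data.Bool using (Bool; true; false; if_then_else_)
open import Data.List using (List; []; _∷_; length; map)
open import Data.Nat.ListAction using (sum)
open import Data.Maybe using (Maybe; just; nothing)
open import Data.Product using (Σ; _×_; _,_; proj₁; proj₂)
open import Data.Sum using (_⊎_)
open import Relation.Nullary using (¬_; yes; no)
open import Relation.Binary.PropositionalEquality using (_≡_; _≢_)
open import Relation.Binary.Bundles using (StrictTotalOrder)

data Ext {a} (A : Set a) : Set a where
  fin : A → Ext A
  ∞   : Ext A

isInf : ∀ {a} {A : Set a} → Ext A → Bool
isInf (fin _) = false
isInf ∞       = true

-- Young diagrams: list of row lengths, row 0 (bottom) first.
-- Boxes: (x , y) with x = column, y = row (French convention).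

Diagram : Set
Diagram = List ℕ

Box : Set
Box = ℕ × ℕ

rowLen : Diagram → ℕ → ℕ
rowLen []      _       = 0
rowLen (n ∷ l) zero    = n
rowLen (n ∷ l) (suc y) = rowLen l y

IsYoung : Diagram → Set
IsYoung λ′ = (∀ y → y < length λ′ → 0 < rowLen λ′ y)
           × (∀ y → rowLen λ′ (suc y) ≤ rowLen λ′ y)

OuterCorner : Diagram → Box → Set
OuterCorner λ′ (x , zero)  = x ≡ rowLen λ′ zero
OuterCorner λ′ (x , suc y) = x ≡ rowLen λ′ (suc y) × x < rowLen λ′ y

addRow : Diagram → ℕ → Diagram
addRow []      zero    = 1 ∷ []
addRow []      (suc y) = []
addRow (n ∷ l) zero    = suc n ∷ l
addRow (n ∷ l) (suc y) = n ∷ addRow l y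

addBox : Diagram → Box → Diagram
addBox λ′ (x , y) = addRow λ′ y

AugDiagram : Set
AugDiagram = Diagram × Box

IsAugmented : AugDiagram → Set
IsAugmented (λ′ , □) = IsYoung λ′ × OuterCorner λ′ □

_↗ᴬ_ : AugDiagram → AugDiagram → Set
(λ′ , □) ↗ᴬ (λ̃ , □̃) =
  IsAugmented (λ′ , □) × IsAugmented (λ̃ , □̃) ×
  Σ Box (λ c → OuterCorner λ′ c × λ̃ ≡ addBox λ′ c
             × (c ≡ □ → OuterCorner λ̃ □̃ × proj₂ □̃ ≡ suc (proj₂ □))
             × (c ≢ □ → □̃ ≡ □))

module _ {a ℓ₁ ℓ₂} (O : StrictTotalOrder a ℓ₁ ℓ₂) where
  open StrictTotalOrder O renaming (Carrier to A; _<_ to _<ₒ_; _<?_ to _<?ₒ_)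

  -- Rows listed bottom (row 0) to top; each row left to right.
  Tableau : Set a
  Tableau = List (List (Ext A))

  data _<ₑ_ : Ext A → Ext A → Set (a ⊔ ℓ₂) where
    fin<fin : ∀ {u v} → u <ₒ v → fin u <ₑ fin v
    fin<∞   : ∀ {u} → fin u <ₑ ∞

  _≤ₑ_ : Ext A → Ext A → Set (a ⊔ ℓ₂)
  u ≤ₑ v = ¬ (v <ₑ u)

  _<ᵇ_ : Ext A → Ext A → Bool
  fin u <ᵇ fin v with u <?ₒ v
  ... | yes _ = true
  ... | no  _ = false
  fin u <ᵇ ∞     = true
  ∞     <ᵇ _     = false

  entry : Tableau → ℕ → ℕ → Maybe (Ext A)   -- entry T x y (column x, row y)
  entry []      _       _       = nothing
  entry (r ∷ T) x       (suc y) = entry T x y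
  entry (r ∷ T) x       zero    = go r x
    where
    go : List (Ext A) → ℕ → Maybe (Ext A)
    go []      _       = nothing
    go (e ∷ r) zero    = just e
    go (e ∷ r) (suc x) = go r x

  shape : Tableau → Diagram
  shape T = map length T

  IsTableau : Tableau → Set (a ⊔ ℓ₂)
  IsTableau T = IsYoung (shape T)
    × (∀ x y u v → entry T x y ≡ just u → entry T (suc x) y ≡ just v → u ≤ₑ v)
    × (∀ x y u v → entry T x y ≡ just u → entry T x (suc y) ≡ just v → u <ₑ v)

  count∞ : Tableau → ℕ
  count∞ T = sum (map cnt T)
    where
    cnt : List (Ext A) → ℕ
    cnt []      = 0
    cnt (e ∷ r) = (if isInf e then 1 else 0) + cnt r

  insertRow : Ext A → List (Ext A) → List (Ext A) × Maybe (Ext A)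
  insertRow u []      = (u ∷ [] , nothing)
  insertRow u (v ∷ r) with u <ᵇ v
  ... | true  = (u ∷ r , just v)
  ... | false = let p = insertRow u r in (v ∷ proj₁ p , proj₂ p)

  insert : Tableau → Ext A → Tableau
  insert []      u = (u ∷ []) ∷ []
  insert (r ∷ T) u with insertRow u r
  ... | (r′ , nothing) = r′ ∷ T
  ... | (r′ , just v)  = r′ ∷ insert T v

  remove∞ : Tableau → Tableau
  remove∞ []      = []
  remove∞ (r ∷ T) with dropRow r
    where
    dropRow : List (Ext A) → List (Ext A)
    dropRow []      = []
    dropRow (e ∷ r) = if isInf e then dropRow r else e ∷ dropRow r
  ... | []      = remove∞ T
  ... | r′@(_ ∷ _) = r′ ∷ remove∞ T

  findInfRow : List (Ext A) → Maybe ℕ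
  findInfRow []      = nothing
  findInfRow (e ∷ r) = if isInf e then just 0 else Data.Maybe.map suc (findInfRow r)

  -- position (x , y) of the (first) ∞ entry; (0 , 0) if there is none
  pos∞ : Tableau → Box
  pos∞ []      = (0 , 0)
  pos∞ (r ∷ T) with findInfRow r
  ... | just x  = (x , 0)
  ... | nothing = let p = pos∞ T in (proj₁ p , suc (proj₂ p))

  sh* : Tableau → AugDiagram
  sh* T = (shape (remove∞ T) , pos∞ T)

module Submission where

-- Since rows weakly increase and ∞ is the largest symbol, the ∞ of T ends its row
-- y₀, and column strictness puts it at an outer corner □ of the regular part λ.
-- Follow the bumping route of x row by row.  The column in which a letter is
-- bumped bounds the column where the bumped letter lands in the next row, so the
-- route ends at an outer corner c of λ.  If the route crosses row y₀ without
-- touching ∞, then c ≠ □, the regular part becomes λ + c and ∞ stays put; if a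
-- letter displaces ∞, then c = □ and ∞ is appended to row y₀ + 1, i.e. it lands
-- at the outer corner of λ + □ directly above □.

open import Defs
open import Level using (_⊔_)
open import Function using (_∘_)
open import Relation.Binary.Bundles using (StrictTotalOrder)
open import Relation.Binary.PropositionalEquality using (_≡_; _≢_; refl; sym; trans; cong; cong₂; subst; subst₂; module ≡-Reasoning)
open import Data.Nat using (ℕ; zero; suc; _+_; _≤_; _<_; z≤n; s≤s; _≟_; _≤?_; pred)
open import Data.Nat.Properties using (≤-refl; ≤-trans; <-≤-trans; ≤-<-trans; n≤1+n; n<1+n; <-irrefl; ≰⇒>; +-comm; m+n≡0⇒m≡0; m+n≡0⇒n≡0)
open import Data.Bool using (Bool; true; false)
open import Data.List using (List; []; _∷_; length; _++_)
open import Data.List.Properties using (length-++)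
open import Data.List.Relation.Unary.All using (All; []; _∷_)
open import Data.List.Relation.Unary.All.Properties using (++⁺)
open import Data.Maybe using (Maybe; just; nothing)
open import Data.Product using (Σ; ∃; _×_; _,_; proj₁; proj₂)
open import Data.Product.Properties using (≡-dec)
open import Data.Sum using (_⊎_; inj₁; inj₂)
open import Data.Empty using (⊥-elim)
open import Relation.Nullary using (¬_; yes; no)

-- Young diagrams and outer corners

-- The box one row higher; the special box of r ∷ T is the lift of that of T.
up : Box → Box
up (x , y) = (x , suc y)

corner-column : ∀ {μ x y} → OuterCorner μ (x , y) → x ≡ rowLen μ y
corner-column {y = zero}  c = c
corner-column {y = suc y} c = proj₁ c

corner-∷ : ∀ {n μ x y} → OuterCorner μ (x , y) → (y ≡ 0 → x < n) → OuterCorner (n ∷ μ) (x , suc y)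
corner-∷ {y = zero}  c x<n = c , x<n refl
corner-∷ {y = suc y} c _   = c

rowLen-addRow-≢ : ∀ μ {k i} → k ≢ i → rowLen (addRow μ k) i ≡ rowLen μ i
rowLen-addRow-≢ []      {zero}  {zero}  k≢i = ⊥-elim (k≢i refl)
rowLen-addRow-≢ []      {zero}  {suc i} k≢i = refl
rowLen-addRow-≢ []      {suc k}         k≢i = refl
rowLen-addRow-≢ (n ∷ μ) {zero}  {zero}  k≢i = ⊥-elim (k≢i refl)
rowLen-addRow-≢ (n ∷ μ) {zero}  {suc i} k≢i = refl
rowLen-addRow-≢ (n ∷ μ) {suc k} {zero}  k≢i = refl
rowLen-addRow-≢ (n ∷ μ) {suc k} {suc i} k≢i = rowLen-addRow-≢ μ (k≢i ∘ cong suc)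

rowLen-addRow-≤ : ∀ μ k i → rowLen μ i ≤ rowLen (addRow μ k) i
rowLen-addRow-≤ []      k       i       = z≤n
rowLen-addRow-≤ (n ∷ μ) zero    zero    = n≤1+n n
rowLen-addRow-≤ (n ∷ μ) zero    (suc i) = ≤-refl
rowLen-addRow-≤ (n ∷ μ) (suc k) zero    = ≤-refl
rowLen-addRow-≤ (n ∷ μ) (suc k) (suc i) = rowLen-addRow-≤ μ k i

corner-addRow : ∀ {μ x k z m} → OuterCorner μ (x , k) → OuterCorner μ (z , m) →
                (x , k) ≢ (z , m) → OuterCorner (addRow μ k) (z , m)
corner-addRow {μ} {x} {k} {z} {m} c d c≢d with k ≟ m
... | yes refl = ⊥-elim (c≢d (cong (_, k) (trans (corner-column {μ} c) (sym (corner-column {μ} d)))))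
... | no k≢m = kept m d k≢m
  where
  kept : ∀ m → OuterCorner μ (z , m) → k ≢ m → OuterCorner (addRow μ k) (z , m)
  kept zero    d k≢m = trans d (sym (rowLen-addRow-≢ μ k≢m))
  kept (suc m) d k≢m = trans (proj₁ d) (sym (rowLen-addRow-≢ μ k≢m)) , <-≤-trans (proj₂ d) (rowLen-addRow-≤ μ k m)

young-[] : IsYoung []
young-[] = (λ y ()) , (λ y → z≤n)

young-∷ : ∀ {n μ} → 0 < n → IsYoung μ → rowLen μ 0 ≤ n → IsYoung (n ∷ μ)
young-∷ {n} {μ} 0<n (nonempty , decreasing) fits = nonempty′ , decreasing′
  where
  nonempty′ : ∀ y → y < length (n ∷ μ) → 0 < rowLen (n ∷ μ) y
  nonempty′ zero    _       = 0<n
  nonempty′ (suc y) (s≤s h) = nonempty y h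
  decreasing′ : ∀ y → rowLen (n ∷ μ) (suc y) ≤ rowLen (n ∷ μ) y
  decreasing′ zero    = fits
  decreasing′ (suc y) = decreasing y

young-tail : ∀ {n μ} → IsYoung (n ∷ μ) → IsYoung μ
young-tail (nonempty , decreasing) = (λ y h → nonempty (suc y) (s≤s h)) , (λ y → decreasing (suc y))

young-head : ∀ {n μ} → IsYoung (n ∷ μ) → 0 < n
young-head (nonempty , _) = nonempty 0 (s≤s z≤n)

young-fits : ∀ {n μ} → IsYoung (n ∷ μ) → rowLen μ 0 ≤ n
young-fits (_ , decreasing) = decreasing 0

young-addRow : ∀ {μ x k} → IsYoung μ → OuterCorner μ (x , k) → IsYoung (addRow μ k)
young-addRow {[]}    {k = zero}  Y c = young-∷ (s≤s z≤n) young-[] z≤n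
young-addRow {[]}    {k = suc k} Y (_ , ())
young-addRow {n ∷ μ} {k = zero}  Y c = young-∷ (s≤s z≤n) (young-tail Y) (≤-trans (young-fits Y) (n≤1+n n))
young-addRow {n ∷ μ} {x} {suc zero} Y (x≡ , x<n) =
  young-∷ (young-head Y) (young-addRow {μ} {x} {zero} (young-tail Y) x≡) (fits μ x≡)
  where
  fits : ∀ μ → x ≡ rowLen μ 0 → rowLen (addRow μ 0) 0 ≤ n
  fits []      _  = young-head Y
  fits (m ∷ μ) x≡ = subst (λ w → suc w ≤ n) x≡ x<n
young-addRow {n ∷ μ} {x} {suc (suc k)} Y c =
  young-∷ (young-head Y) (young-addRow {μ} {x} {suc k} (young-tail Y) c)
          (subst (_≤ n) (sym (rowLen-addRow-≢ μ {suc k} {0} (λ ()))) (young-fits Y))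

-- Augmented steps

-- The bound is what allows a step
-- in the rows above some row to be lifted underneath it.
record Grow (j : ℕ) (X Y : AugDiagram) : Set where
  constructor grow
  field
    corner      : Box
    isCorner    : OuterCorner (proj₁ X) corner
    grown       : proj₁ Y ≡ addBox (proj₁ X) corner
    atSpecial   : corner ≡ proj₂ X → OuterCorner (proj₁ Y) (proj₂ Y) × proj₂ (proj₂ Y) ≡ suc (proj₂ (proj₂ X))
    offSpecial  : corner ≢ proj₂ X → proj₂ Y ≡ proj₂ X
    bottomBound : proj₂ corner ≡ 0 → proj₁ corner ≤ j

-- From an augmented diagram, a `Grow` step is an edge of the augmented Young
-- graph: the target is augmented because adding a corner keeps the diagram
-- Young, and either the special box was the added corner (then `atSpecial`
-- gives the new one) or it is another outer corner and survives.
grow⇒↗ : ∀ {j X Y} → IsAugmented X → Grow j X Y → X ↗ᴬ Y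
grow⇒↗ {X = μ , □} {Y = μ̃ , □̃} (young , □-corner) (grow c corner refl atSpecial offSpecial _) =
  (young , □-corner) , (young-addRow young corner , □̃-corner) , c , corner , refl , atSpecial , offSpecial
  where
  □̃-corner : OuterCorner μ̃ □̃
  □̃-corner with ≡-dec _≟_ _≟_ c □
  ... | yes c≡□ = proj₁ (atSpecial c≡□)
  ... | no  c≢□ = subst (OuterCorner μ̃) (sym (offSpecial c≢□)) (corner-addRow corner □-corner c≢□)

-- Insertion into an empty tableau opens a first row; ∞ moves on top of it.
grow-empty : ∀ {j} → Grow j ([] , (0 , 0)) (1 ∷ [] , (0 , 1))
grow-empty = grow (0 , 0) refl refl (λ _ → (refl , s≤s z≤n) , refl) (λ c≢□ → ⊥-elim (c≢□ refl)) (λ _ → z≤n)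

grow-append : ∀ {j n μ b} → n ≤ j → Grow j (n ∷ μ , up b) (suc n ∷ μ , up b)
grow-append n≤j = grow (_ , 0) refl refl (λ ()) (λ _ → refl) (λ _ → n≤j)

grow-lift : ∀ {j q n μ μ̃ b b̃} → q < n → Grow q (μ , b) (μ̃ , b̃) → Grow j (n ∷ μ , up b) (n ∷ μ̃ , up b̃)
grow-lift {n = n} {μ̃ = μ̃} {b = bx , by} {b̃ = b̃x , b̃y} q<n (grow (cx , cy) corner grown atSpecial offSpecial bound) =
  grow (cx , suc cy) (corner-∷ corner (λ cy≡0 → ≤-<-trans (bound cy≡0) q<n)) (cong (_ ∷_) grown)
       atSpecial′ offSpecial′ (λ ())
  where
  down : Box → Box
  down (x , y) = (x , pred y)
  atSpecial′ : (cx , suc cy) ≡ (bx , suc by) → OuterCorner (n ∷ μ̃) (b̃x , suc b̃y) × suc b̃y ≡ suc (suc by)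
  atSpecial′ c≡b with atSpecial (cong down c≡b)
  ... | special′ , refl = special′ , refl
  offSpecial′ : (cx , suc cy) ≢ (bx , suc by) → (b̃x , suc b̃y) ≡ (bx , suc by)
  offSpecial′ c≢b = cong up (offSpecial (c≢b ∘ cong up))

grow-under-special : ∀ {j q n μ μ̃ b b̃} → q < n → Grow q (μ , b) (μ̃ , b̃) → Grow j (n ∷ μ , (n , 0)) (n ∷ μ̃ , (n , 0))
grow-under-special q<n (grow (cx , cy) corner grown _ _ bound) =
  grow (cx , suc cy) (corner-∷ corner (λ cy≡0 → ≤-<-trans (bound cy≡0) q<n)) (cong (_ ∷_) grown)
       (λ ()) (λ _ → refl) (λ ())

grow-displace : ∀ {j n μ} → n ≤ j → rowLen μ 0 ≤ n → Grow j (n ∷ μ , (n , 0)) (suc n ∷ μ , (rowLen μ 0 , 1))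
grow-displace n≤j fits = grow (_ , 0) refl refl (λ _ → (refl , s≤s fits) , refl) (λ c≢□ → ⊥-elim (c≢□ refl)) (λ _ → n≤j)

-- Row insertion into tableaux with at most one ∞, over a strict total order O.

module Insertion {a ℓ₁ ℓ₂} (O : StrictTotalOrder a ℓ₁ ℓ₂) where
  open StrictTotalOrder O using () renaming (Carrier to A; _<?_ to _<?ₒ_)

  Entry : Set a
  Entry = Ext A

  Row : Set a
  Row = List Entry

  Tab : Set a
  Tab = Tableau O

  _≺_ : Entry → Entry → Set (a ⊔ ℓ₂)
  _≺_ = _<ₑ_ O

  rowInsert : Entry → Row → Row × Maybe Entry
  rowInsert = insertRow O

  ins : Tab → Entry → Tab
  ins = insert O

  sh : Tab → AugDiagram
  sh = sh* O

  regular : Tab → Diagram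
  regular T = proj₁ (sh T)

  special : Tab → Box
  special T = proj₂ (sh T)

  IsFin : Entry → Set
  IsFin e = isInf e ≡ false

  FinRow : Row → Set a
  FinRow = All IsFin

  NonEmpty : Row → Set
  NonEmpty r = 0 < length r

  bottomRow : Tab → Row
  bottomRow []      = []
  bottomRow (r ∷ _) = r

  at : Row → ℕ → Maybe Entry
  at []      _       = nothing
  at (e ∷ r) zero    = just e
  at (e ∷ r) (suc i) = at r i

  ColumnStrict : Row → Row → Set (a ⊔ ℓ₂)
  ColumnStrict r s = ∀ i e f → at r i ≡ just e → at s i ≡ just f → e ≺ f

  -- The entry of r in column j, if there is one, exceeds u.  Then u cannot
  -- pass column j, so u lands in a column at most j.
  Bounded : ℕ → Entry → Row → Set (a ⊔ ℓ₂)
  Bounded j u r = ∀ e → at r j ≡ just e → u ≺ e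

  length-snoc : ∀ (r : Row) e → length (r ++ e ∷ []) ≡ suc (length r)
  length-snoc r e = trans (length-++ r) (+-comm (length r) 1)

  at-snoc : ∀ (r : Row) e → at (r ++ e ∷ []) (length r) ≡ just e
  at-snoc []      e = refl
  at-snoc (_ ∷ r) e = at-snoc r e

  at-defined : ∀ (r : Row) {i} → i < length r → ∃ λ f → at r i ≡ just f
  at-defined (f ∷ r) {zero}  _       = f , refl
  at-defined (_ ∷ r) {suc i} (s≤s h) = at-defined r h

  bounded-end : ∀ {u} r → Bounded (length r) u r
  bounded-end []      e ()
  bounded-end (_ ∷ r) e h = bounded-end r e h

  ≺⇒≺ᵇ : ∀ {u v} → u ≺ v → _<ᵇ_ O u v ≡ true
  ≺⇒≺ᵇ (fin<fin {u} {v} u<v) with u <?ₒ v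
  ... | yes _   = refl
  ... | no  u≮v = ⊥-elim (u≮v u<v)
  ≺⇒≺ᵇ fin<∞ = refl

  bounded-pass : ∀ {j u w r} → _<ᵇ_ O u w ≡ false → Bounded j u (w ∷ r) →
                 Σ ℕ λ j′ → j ≡ suc j′ × Bounded j′ u r
  bounded-pass {zero} passed bound with trans (sym (≺⇒≺ᵇ (bound _ refl))) passed
  ... | ()
  bounded-pass {suc j} passed bound = j , refl , bound

  data RowInsertion (r : Row) (j : ℕ) : Row × Maybe Entry → Set a where
    appended : ∀ {r′} → FinRow r′ → length r′ ≡ suc (length r) → length r ≤ j →
               RowInsertion r j (r′ , nothing)
    bumped   : ∀ {r′ v p} → FinRow r′ → length r′ ≡ length r → IsFin v → p < length r → at r p ≡ just v →
               RowInsertion r j (r′ , just v)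

  rowInsertion : ∀ {u j} r → IsFin u → FinRow r → Bounded j u r → RowInsertion r j (rowInsert u r)
  rowInsertion []      fu _ _ = appended (fu ∷ []) refl z≤n
  rowInsertion {u} {j} (w ∷ r) fu (fw ∷ fr) bound with _<ᵇ_ O u w in passed
  ... | true  = bumped (fu ∷ fr) refl fw (s≤s z≤n) refl
  ... | false with bounded-pass {j} {r = r} passed bound
  ...   | j′ , refl , bound′ with rowInsert u r | rowInsertion r fu fr bound′
  ...     | _ | appended fr′ len r≤j   = appended (fw ∷ fr′) (cong suc len) (s≤s r≤j)
  ...     | _ | bumped fr′ len fv p< at≡ = bumped (fw ∷ fr′) (cong suc len) fv (s≤s p<) at≡

  data InfRowInsertion (x : A) (r₀ : Row) (j : ℕ) : Row × Maybe Entry → Set a where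
    bumpsFinite : ∀ {r₀′ v p} → FinRow r₀′ → length r₀′ ≡ length r₀ → IsFin v → p < length r₀ →
                  at (r₀ ++ ∞ ∷ []) p ≡ just v → InfRowInsertion x r₀ j (r₀′ ++ ∞ ∷ [] , just v)
    displaces∞  : length r₀ ≤ j → InfRowInsertion x r₀ j (r₀ ++ fin x ∷ [] , just ∞)

  infRowInsertion : ∀ {x j} r₀ → FinRow r₀ → Bounded j (fin x) (r₀ ++ ∞ ∷ []) →
                    InfRowInsertion x r₀ j (rowInsert (fin x) (r₀ ++ ∞ ∷ []))
  infRowInsertion []      _ _ = displaces∞ z≤n
  infRowInsertion {x} {j} (w ∷ r₀) (fw ∷ fr) bound with _<ᵇ_ O (fin x) w in passed
  ... | true  = bumpsFinite {r₀′ = fin x ∷ r₀} (refl ∷ fr) refl fw (s≤s z≤n) refl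
  ... | false with bounded-pass {j} {r = r₀ ++ ∞ ∷ []} passed bound
  ...   | j′ , refl , bound′ with rowInsert (fin x) (r₀ ++ ∞ ∷ []) | infRowInsertion r₀ fr bound′
  ...     | _ | bumpsFinite {r₀′} fr′ len fv p< at≡ = bumpsFinite {r₀′ = w ∷ r₀′} (fw ∷ fr′) (cong suc len) fv (s≤s p<) at≡
  ...     | _ | displaces∞ r₀≤j = displaces∞ (s≤s r₀≤j)

  -- ∞ is never smaller than an entry, so it is appended to any row.
  rowInsert-∞ : ∀ r → rowInsert ∞ r ≡ (r ++ ∞ ∷ [] , nothing)
  rowInsert-∞ []      = refl
  rowInsert-∞ (w ∷ r) = cong (λ p → (w ∷ proj₁ p , proj₂ p)) (rowInsert-∞ r)

  continue : Tab → Maybe Entry → Tab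
  continue T nothing  = T
  continue T (just v) = ins T v

  insert-∷ : ∀ r T u → ins (r ∷ T) u ≡ proj₁ (rowInsert u r) ∷ continue T (proj₂ (rowInsert u r))
  insert-∷ r T u with rowInsert u r
  ... | r′ , nothing = refl
  ... | r′ , just v  = refl

  data Stack : Bool → Tab → Set (a ⊔ ℓ₂) where
    empty       : Stack false []
    finiteRow   : ∀ {b r T} → FinRow r → NonEmpty r → ColumnStrict r (bottomRow T) →
                  length (bottomRow T) ≤ length r → Stack b T → Stack b (r ∷ T)
    lone∞       : Stack true ((∞ ∷ []) ∷ [])
    infinityRow : ∀ {r₀ G} → FinRow r₀ → NonEmpty r₀ → ColumnStrict (r₀ ++ ∞ ∷ []) (bottomRow G) →
                  length (bottomRow G) ≤ length r₀ → Stack false G → Stack true ((r₀ ++ ∞ ∷ []) ∷ G)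

  rowLen-shape : ∀ T → rowLen (shape O T) 0 ≡ length (bottomRow T)
  rowLen-shape []      = refl
  rowLen-shape (r ∷ T) = refl

  -- remove∞ keeps finite rows and cuts ∞ off its row.  It filters rows by a
  -- local function, so the inductions recurse through remove∞ on a single row.
  remove∞-finiteRow : ∀ {r} T → FinRow r → NonEmpty r → remove∞ O (r ∷ T) ≡ r ∷ remove∞ O T
  remove∞-finiteRow {∞ ∷ _}          T (() ∷ _)      _
  remove∞-finiteRow {fin _ ∷ ∞ ∷ _}  T (_ ∷ () ∷ _)  _
  remove∞-finiteRow {fin b ∷ []}    T _              _ = refl
  remove∞-finiteRow {fin b ∷ fin c ∷ r} T (_ ∷ fc ∷ fr) _ =
    cong (λ row → (fin b ∷ row) ∷ remove∞ O T) (cong bottomRow (remove∞-finiteRow {fin c ∷ r} [] (fc ∷ fr) (s≤s z≤n)))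

  remove∞-infinityRow : ∀ {r₀} G → FinRow r₀ → NonEmpty r₀ → remove∞ O ((r₀ ++ ∞ ∷ []) ∷ G) ≡ r₀ ∷ remove∞ O G
  remove∞-infinityRow {∞ ∷ _}          G (() ∷ _)      _
  remove∞-infinityRow {fin _ ∷ ∞ ∷ _}  G (_ ∷ () ∷ _)  _
  remove∞-infinityRow {fin b ∷ []}    G _              _ = refl
  remove∞-infinityRow {fin b ∷ fin c ∷ r} G (_ ∷ fc ∷ fr) _ =
    cong (λ row → (fin b ∷ row) ∷ remove∞ O G) (cong bottomRow (remove∞-infinityRow {fin c ∷ r} [] (fc ∷ fr) (s≤s z≤n)))

  remove∞-finite : ∀ {G} → Stack false G → remove∞ O G ≡ G
  remove∞-finite empty                            = refl
  remove∞-finite (finiteRow {T = T} fr ne _ _ st) = trans (remove∞-finiteRow T fr ne) (cong (_ ∷_) (remove∞-finite st))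

  findInfRow-finite : ∀ {r} → FinRow r → findInfRow O r ≡ nothing
  findInfRow-finite []                  = refl
  findInfRow-finite {fin _ ∷ _} (_ ∷ fr) rewrite findInfRow-finite fr = refl

  findInfRow-∞ : ∀ {r₀} → FinRow r₀ → findInfRow O (r₀ ++ ∞ ∷ []) ≡ just (length r₀)
  findInfRow-∞ []                  = refl
  findInfRow-∞ {fin _ ∷ _} (_ ∷ fr) rewrite findInfRow-∞ fr = refl

  sh-finiteRow : ∀ {r T} → FinRow r → NonEmpty r → sh (r ∷ T) ≡ (length r ∷ regular T , up (special T))
  sh-finiteRow {r} {T} fr ne = cong₂ _,_ (cong (shape O) (remove∞-finiteRow T fr ne)) special-lifted
    where
    special-lifted : pos∞ O (r ∷ T) ≡ up (special T)
    special-lifted rewrite findInfRow-finite fr = refl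

  sh-infinityRow : ∀ {r₀ G} → FinRow r₀ → NonEmpty r₀ → sh ((r₀ ++ ∞ ∷ []) ∷ G) ≡ (length r₀ ∷ regular G , (length r₀ , 0))
  sh-infinityRow {r₀} {G} fr ne = cong₂ _,_ (cong (shape O) (remove∞-infinityRow G fr ne)) special-here
    where
    special-here : pos∞ O ((r₀ ++ ∞ ∷ []) ∷ G) ≡ (length r₀ , 0)
    special-here rewrite findInfRow-∞ fr = refl

  sh-insert-∞ : ∀ {G} → Stack false G → sh (ins G ∞) ≡ (shape O G , (rowLen (shape O G) 0 , 0))
  sh-insert-∞ empty = refl
  sh-insert-∞ (finiteRow {r = g} {T = G} fg ng _ _ st) = begin
    sh (ins (g ∷ G) ∞)
      ≡⟨ cong sh (trans (insert-∷ g G ∞) (cong (λ p → proj₁ p ∷ continue G (proj₂ p)) (rowInsert-∞ g))) ⟩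
    sh ((g ++ ∞ ∷ []) ∷ G)
      ≡⟨ sh-infinityRow fg ng ⟩
    (length g ∷ shape O (remove∞ O G) , (length g , 0))
      ≡⟨ cong (λ H → (length g ∷ shape O H , (length g , 0))) (remove∞-finite st) ⟩
    (length g ∷ shape O G , (length g , 0))
      ∎
    where open ≡-Reasoning

  regular-young : ∀ {b T} → Stack b T → IsYoung (regular T) × rowLen (regular T) 0 ≤ length (bottomRow T)
  regular-young empty = young-[] , z≤n
  regular-young lone∞ = young-[] , z≤n
  regular-young (finiteRow {r = r} {T = T} fr ne _ len st) =
    subst (λ μ → IsYoung μ × rowLen μ 0 ≤ length r) (sym (cong proj₁ (sh-finiteRow {T = T} fr ne)))
          (young-∷ ne young (≤-trans fits len) , ≤-refl)
    where
    young : IsYoung (regular T)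
    young = proj₁ (regular-young st)
    fits : rowLen (regular T) 0 ≤ length (bottomRow T)
    fits = proj₂ (regular-young st)
  regular-young (infinityRow {r₀} {G} fr ne _ len st) =
    subst (λ μ → IsYoung μ × rowLen μ 0 ≤ length (r₀ ++ ∞ ∷ [])) (sym (cong proj₁ (sh-infinityRow {G = G} fr ne)))
          (young-∷ ne young (≤-trans fits len) , subst (length r₀ ≤_) (sym (length-snoc r₀ ∞)) (n≤1+n _))
    where
    young : IsYoung (regular G)
    young = proj₁ (regular-young st)
    fits : rowLen (regular G) 0 ≤ length (bottomRow G)
    fits = proj₂ (regular-young st)

  -- The special box is an outer corner of the regular part, which a finite row
  -- underneath may have to support: a special box in the bottom row lies left
  -- of the end of the bottom row of the tableau.
  SpecialFits : Row → AugDiagram → Set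
  SpecialFits r (μ , (x , y)) = OuterCorner μ (x , y) × (y ≡ 0 → x < length r)

  special-fits : ∀ {T} → Stack true T → SpecialFits (bottomRow T) (sh T)
  special-fits lone∞ = refl , (λ _ → s≤s z≤n)
  special-fits (finiteRow {r = r} {T = T} fr ne _ len st) =
    subst (SpecialFits r) (sym (sh-finiteRow {T = T} fr ne))
          (corner-∷ (proj₁ (special-fits st)) (λ y≡0 → <-≤-trans (proj₂ (special-fits st) y≡0) len) , (λ ()))
  special-fits (infinityRow {r₀} {G} fr ne _ _ _) =
    subst (SpecialFits (r₀ ++ ∞ ∷ [])) (sym (sh-infinityRow {G = G} fr ne))
          (refl , (λ _ → subst (length r₀ <_) (sym (length-snoc r₀ ∞)) (n<1+n _)))

  augmented : ∀ {T} → Stack true T → IsAugmented (sh T)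
  augmented st = proj₁ (regular-young st) , proj₁ (special-fits st)

  -- Insertion, one row at a time.

  Grows : Tab → Set (a ⊔ ℓ₂)
  Grows T = ∀ {v p} → IsFin v → Bounded p v (bottomRow T) → Grow p (sh T) (sh (ins T v))

  -- Below a finite bottom row r: u is appended (the corner ends the bottom row)
  -- or bumps v from column p < |r|, and the step above, bounded by p thanks to
  -- column strictness, lifts underneath r.
  step-finiteRow : ∀ {r T u j} → IsFin u → FinRow r → NonEmpty r → ColumnStrict r (bottomRow T) →
                   Bounded j u r → Grows T → Grow j (sh (r ∷ T)) (sh (ins (r ∷ T) u))
  step-finiteRow {r} {T} {u} {j} fu fr ne cs bound grows
    with rowInsert u r | rowInsertion r fu fr bound | insert-∷ r T u
  ... | r′ , _ | appended fr′ len r≤j | inserted =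
    subst₂ (Grow j) (sym (sh-finiteRow fr ne)) (sym (trans (cong sh inserted) sh-after)) (grow-append r≤j)
    where
    open ≡-Reasoning
    sh-after : sh (r′ ∷ T) ≡ (suc (length r) ∷ regular T , up (special T))
    sh-after = begin
      sh (r′ ∷ T)                             ≡⟨ sh-finiteRow fr′ (subst (0 <_) (sym len) (s≤s z≤n)) ⟩
      (length r′ ∷ regular T , up (special T)) ≡⟨ cong (λ n → (n ∷ regular T , up (special T))) len ⟩
      (suc (length r) ∷ regular T , up (special T)) ∎
  ... | r′ , _ | bumped {v = v} fr′ len fv p< at≡ | inserted =
    subst₂ (Grow j) (sym (sh-finiteRow fr ne)) (sym (trans (cong sh inserted) sh-after))
           (grow-lift p< (grows fv (λ f at₁ → cs _ v f at≡ at₁)))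
    where
    open ≡-Reasoning
    sh-after : sh (r′ ∷ ins T v) ≡ (length r ∷ regular (ins T v) , up (special (ins T v)))
    sh-after = begin
      sh (r′ ∷ ins T v)                                      ≡⟨ sh-finiteRow fr′ (subst (0 <_) (sym len) ne) ⟩
      (length r′ ∷ regular (ins T v) , up (special (ins T v))) ≡⟨ cong (λ n → (n ∷ regular (ins T v) , up (special (ins T v)))) len ⟩
      (length r ∷ regular (ins T v) , up (special (ins T v)))  ∎

  -- In the row r₀ ++ [∞] of ∞: fin x bumps a finite v from column p < |r₀| and
  -- the step happens in the finite rows above, or fin x displaces ∞, which is
  -- then appended to the row above.
  step-infinityRow : ∀ {r₀ G x j} → FinRow r₀ → NonEmpty r₀ → ColumnStrict (r₀ ++ ∞ ∷ []) (bottomRow G) →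
                     length (bottomRow G) ≤ length r₀ → Stack false G → Bounded j (fin x) (r₀ ++ ∞ ∷ []) →
                     Grows G → Grow j (sh ((r₀ ++ ∞ ∷ []) ∷ G)) (sh (ins ((r₀ ++ ∞ ∷ []) ∷ G) (fin x)))
  step-infinityRow {r₀} {G} {x} {j} fr ne cs len st bound grows
    with rowInsert (fin x) (r₀ ++ ∞ ∷ []) | infRowInsertion r₀ fr bound | insert-∷ (r₀ ++ ∞ ∷ []) G (fin x)
  ... | _ | bumpsFinite {r₀′} {v} fr′ len′ fv p< at≡ | inserted =
    subst₂ (Grow j) (sym (sh-infinityRow fr ne)) (sym (trans (cong sh inserted) sh-after))
           (grow-under-special p< (grows fv (λ f at₁ → cs _ v f at≡ at₁)))
    where
    open ≡-Reasoning
    sh-after : sh ((r₀′ ++ ∞ ∷ []) ∷ ins G v) ≡ (length r₀ ∷ regular (ins G v) , (length r₀ , 0))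
    sh-after = begin
      sh ((r₀′ ++ ∞ ∷ []) ∷ ins G v)                     ≡⟨ sh-infinityRow fr′ (subst (0 <_) (sym len′) ne) ⟩
      (length r₀′ ∷ regular (ins G v) , (length r₀′ , 0)) ≡⟨ cong (λ n → (n ∷ regular (ins G v) , (n , 0))) len′ ⟩
      (length r₀ ∷ regular (ins G v) , (length r₀ , 0))   ∎
  ... | _ | displaces∞ r₀≤j | inserted =
    subst₂ (Grow j) (sym sh-before) (sym (trans (cong sh inserted) sh-after)) (grow-displace r₀≤j fits)
    where
    open ≡-Reasoning
    fits : rowLen (shape O G) 0 ≤ length r₀
    fits = subst (_≤ length r₀) (sym (rowLen-shape G)) len
    sh-before : sh ((r₀ ++ ∞ ∷ []) ∷ G) ≡ (length r₀ ∷ shape O G , (length r₀ , 0))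
    sh-before = trans (sh-infinityRow fr ne) (cong (λ H → (length r₀ ∷ shape O H , (length r₀ , 0))) (remove∞-finite st))
    sh-after : sh ((r₀ ++ fin x ∷ []) ∷ ins G ∞) ≡ (suc (length r₀) ∷ shape O G , (rowLen (shape O G) 0 , 1))
    sh-after = begin
      sh ((r₀ ++ fin x ∷ []) ∷ ins G ∞)
        ≡⟨ sh-finiteRow (++⁺ fr (refl ∷ [])) (subst (0 <_) (sym (length-snoc r₀ (fin x))) (s≤s z≤n)) ⟩
      (length (r₀ ++ fin x ∷ []) ∷ regular (ins G ∞) , up (special (ins G ∞)))
        ≡⟨ cong₂ (λ n X → (n ∷ proj₁ X , up (proj₂ X))) (length-snoc r₀ (fin x)) (sh-insert-∞ st) ⟩
      (suc (length r₀) ∷ shape O G , (rowLen (shape O G) 0 , 1))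
        ∎

  insert-grows : ∀ {b T} → Stack b T → Grows T
  insert-grows _                             {v = ∞}     ()
  insert-grows empty                         {v = fin x} _  _     = grow-empty
  insert-grows lone∞                         {v = fin x} _  _     = grow-empty
  insert-grows (finiteRow fr ne cs _ st)                 fv bound = step-finiteRow fv fr ne cs bound (insert-grows st)
  insert-grows (infinityRow fr ne cs len st) {v = fin x} _  bound = step-infinityRow fr ne cs len st bound (insert-grows st)

  -- From IsTableau to Stack.

  rowCount : Row → ℕ
  rowCount r = count∞ O (r ∷ [])

  count∞-∷ : ∀ r T → count∞ O (r ∷ T) ≡ rowCount r + count∞ O T
  count∞-∷ []          T = refl
  count∞-∷ (fin _ ∷ r) T = count∞-∷ r T
  count∞-∷ (∞ ∷ r)     T = cong suc (count∞-∷ r T)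

  finite-row : ∀ r → rowCount r ≡ 0 → FinRow r
  finite-row []          _ = []
  finite-row (fin _ ∷ r) h = refl ∷ finite-row r h
  finite-row (∞ ∷ r)     ()

  WeaklyIncreasing : Row → Set (a ⊔ ℓ₂)
  WeaklyIncreasing r = ∀ i e f → at r i ≡ just e → at r (suc i) ≡ just f → ¬ (f ≺ e)

  ∞-last : ∀ r → rowCount r ≡ 1 → WeaklyIncreasing r → ∃ λ r₀ → r ≡ r₀ ++ ∞ ∷ [] × FinRow r₀
  ∞-last []                 ()
  ∞-last (fin a ∷ r)        one incr with ∞-last r one (λ i → incr (suc i))
  ... | r₀ , refl , fr = fin a ∷ r₀ , refl , refl ∷ fr
  ∞-last (∞ ∷ [])           _   _    = [] , refl , []
  ∞-last (∞ ∷ fin b ∷ r)    _   incr = ⊥-elim (incr 0 ∞ (fin b) refl refl fin<∞)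
  ∞-last (∞ ∷ ∞ ∷ r)        ()  _

  entry-bottom : ∀ r T i → entry O (r ∷ T) i 0 ≡ at r i
  entry-bottom []      T i       = refl
  entry-bottom (e ∷ r) T zero    = refl
  entry-bottom (e ∷ r) T (suc i) = entry-bottom r T i

  entry-bottomRow : ∀ T i → entry O T i 0 ≡ at (bottomRow T) i
  entry-bottomRow []      i = refl
  entry-bottomRow (r ∷ T) i = entry-bottom r T i

  module _ {r T} (tableau : IsTableau O (r ∷ T)) where
    private
      young : IsYoung (shape O (r ∷ T))
      young = proj₁ tableau
      rowWeak : ∀ x y u v → entry O (r ∷ T) x y ≡ just u → entry O (r ∷ T) (suc x) y ≡ just v → ¬ (v ≺ u)
      rowWeak = proj₁ (proj₂ tableau)
      colStrict : ∀ x y u v → entry O (r ∷ T) x y ≡ just u → entry O (r ∷ T) x (suc y) ≡ just v → u ≺ v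
      colStrict = proj₂ (proj₂ tableau)

    tableau-above : IsTableau O T
    tableau-above = young-tail young , (λ x y → rowWeak x (suc y)) , (λ x y → colStrict x (suc y))

    bottom-nonEmpty : NonEmpty r
    bottom-nonEmpty = young-head young

    bottom-columnStrict : ColumnStrict r (bottomRow T)
    bottom-columnStrict i e f at₁ at₂ = colStrict i 0 e f (trans (entry-bottom r T i) at₁) (trans (entry-bottomRow T i) at₂)

    bottom-fits : length (bottomRow T) ≤ length r
    bottom-fits = subst (_≤ length r) (rowLen-shape T) (young-fits young)

    bottom-weak : WeaklyIncreasing r
    bottom-weak i e f at₁ at₂ = rowWeak i 0 e f (trans (entry-bottom r T i) at₁) (trans (entry-bottom r T (suc i)) at₂)

  stack-finite : ∀ T → IsTableau O T → count∞ O T ≡ 0 → Stack false T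
  stack-finite []      _       _    = empty
  stack-finite (r ∷ T) tableau none =
    finiteRow (finite-row r (m+n≡0⇒m≡0 (rowCount r) none′)) (bottom-nonEmpty tableau) (bottom-columnStrict tableau)
              (bottom-fits tableau) (stack-finite T (tableau-above tableau) (m+n≡0⇒n≡0 (rowCount r) none′))
    where
    none′ : rowCount r + count∞ O T ≡ 0
    none′ = trans (sym (count∞-∷ r T)) none

  split-one : ∀ m n → m + n ≡ 1 → (m ≡ 0 × n ≡ 1) ⊎ (m ≡ 1 × n ≡ 0)
  split-one zero          n    m+n≡1 = inj₁ (refl , m+n≡1)
  split-one (suc zero)    zero _     = inj₂ (refl , refl)
  split-one (suc zero)    (suc n) ()
  split-one (suc (suc m)) n    ()

  -- Nothing lies above ∞ in a column-strict tableau, so the row above r₀ ++ [∞]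
  -- is no longer than r₀.
  fits-under-∞ : ∀ r₀ s → ColumnStrict (r₀ ++ ∞ ∷ []) s → length s ≤ length r₀
  fits-under-∞ r₀ s cs with length s ≤? length r₀
  ... | yes fits = fits
  ... | no ¬fits with at-defined s (≰⇒> ¬fits)
  ...   | f , at-f with cs (length r₀) ∞ f (at-snoc r₀ ∞) at-f
  ...     | ()

  -- A row r₀ ++ [∞] under a finite stack; if r₀ = [] the stack must be empty,
  -- since its rows are nonempty.
  stack-∞-bottom : ∀ {r₀ G} → FinRow r₀ → ColumnStrict (r₀ ++ ∞ ∷ []) (bottomRow G) →
                   length (bottomRow G) ≤ length r₀ → Stack false G → Stack true ((r₀ ++ ∞ ∷ []) ∷ G)
  stack-∞-bottom {[]}    _  _  _    empty                 = lone∞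
  stack-∞-bottom {[]}    _  _  fits (finiteRow _ ne _ _ _) = ⊥-elim (<-irrefl refl (<-≤-trans ne fits))
  stack-∞-bottom {_ ∷ _} fr cs fits st                    = infinityRow fr (s≤s z≤n) cs fits st

  -- A tableau with one ∞ is a stack: below the row of ∞ all rows are finite,
  -- that row is r₀ ++ [∞], and everything above it is a finite stack.
  stack-one : ∀ T → IsTableau O T → count∞ O T ≡ 1 → Stack true T
  stack-one []      _       ()
  stack-one (r ∷ T) tableau one with split-one (rowCount r) (count∞ O T) (trans (sym (count∞-∷ r T)) one)
  ... | inj₁ (r-none , T-one) =
    finiteRow (finite-row r r-none) (bottom-nonEmpty tableau) (bottom-columnStrict tableau) (bottom-fits tableau)
              (stack-one T (tableau-above tableau) T-one)
  ... | inj₂ (r-one , T-none) with ∞-last r r-one (bottom-weak tableau)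
  ...   | r₀ , refl , fr =
    stack-∞-bottom fr cs (fits-under-∞ r₀ (bottomRow T) cs) (stack-finite T (tableau-above tableau) T-none)
    where
    cs : ColumnStrict (r₀ ++ ∞ ∷ []) (bottomRow T)
    cs = bottom-columnStrict tableau

lemma3p3 : ∀ {a ℓ₁ ℓ₂} (O : StrictTotalOrder a ℓ₁ ℓ₂) (T : Tableau O)
           (x : StrictTotalOrder.Carrier O) →
           IsTableau O T → count∞ O T ≡ 1 →
           sh* O T ↗ᴬ sh* O (insert O T (fin x))
lemma3p3 O T x tableau one =
  grow⇒↗ (augmented stack) (insert-grows stack refl (bounded-end (bottomRow T)))
  where
  open Insertion O
  stack : Stack true T
  stack = stack-one T tableau one
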